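{- Let $p$ be a prime, $q=p^n$ with $q\equiv 1\pmod 3$, $\delta\in\mathbb{F}_q$ a cubic nonresidue, and let $\mathbb{H}_q$ with its $\mathrm{GL}_3(\mathbb{F}_q)$-action be as in the context. Let $B\leq\mathrm{GL}_3(\mathbb{F}_q)$ be the Borel subgroup of invertible upper-triangular matrices. Then \[ \{(\delta^{1/3},\ v\delta^{1/3}+\delta^{2/3}) : v\in\mathbb{F}_q\}\ \sqcup\ \{(\delta^{2/3},\ \delta^{1/3})\} \] is a fundamental domain for the action of $B$ on $\mathbb{H}_q$, i.e. it contains exactly one element of each $B$-orbit.
   Context: $\mathbb{F}_q(\sqrt[3]{\delta})\cong\mathbb{F}_{q^3}$ has $\mathbb{F}_q$-basis $\{1,\delta^{1/3},\delta^{2/3}\}$; write $\alpha=\alpha_1+\alpha_2\delta^{1/3}+\alpha_3\delta^{2/3}$ with $\alpha_i\in\mathbb{F}_q$. $\mathbb{H}_q=\{(\alpha,\beta)\in\mathbb{F}_q(\sqrt[3]{\delta})^2 : \alpha_2\beta_3-\alpha_3\beta_2\neq 0\}$, with $\mathrm{GL}_3(\mathbb{F}_q)$ acting by $\begin{bmatrix} a & b & c\\ d & e & f\\ r & s & t\end{bmatrix}(\alpha,\beta)=\left(\frac{a\alpha+b\beta+c}{r\alpha+s\beta+t},\frac{d\alpha+e\beta+f}{r\alpha+s\beta+t}\right)$. -}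

module Defs where

open import Level using (Level; _⊔_)
open import Data.Fin using (Fin)
import Data.Fin as Fin
open import Data.Product using (Σ; ∃; _×_; _,_)
open import Data.Sum using (_⊎_)
open import Relation.Nullary using (¬_)
open import Relation.Binary.PropositionalEquality as ≡ using (_≡_)
open import Function.Bundles using (Inverse)
open import Algebra.Bundles using (CommutativeRing)

IsField : ∀ {c ℓ} → CommutativeRing c ℓ → Set (c ⊔ ℓ)
IsField R = (¬ (0# ≈ 1#)) × (∀ x → ¬ (x ≈ 0#) → Σ Carrier λ y → (x * y) ≈ 1#)
  where open CommutativeRing R

HasCardinality : ∀ {c ℓ} → CommutativeRing c ℓ → (q : _) → Set (c ⊔ ℓ)
HasCardinality R q = Inverse (CommutativeRing.setoid R) (≡.setoid (Fin q))

CubicNonresidue : ∀ {c ℓ} (R : CommutativeRing c ℓ) → CommutativeRing.Carrier R → Set (c ⊔ ℓ)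
CubicNonresidue R δ = ¬ (Σ Carrier λ x → (x * x * x) ≈ δ)
  where open CommutativeRing R

module CubicExt {c ℓ} (F : CommutativeRing c ℓ) (δ : CommutativeRing.Carrier F) where
  open CommutativeRing F

  -- element α₁ + α₂ δ^{1/3} + α₃ δ^{2/3} of F(δ^{1/3}), stored as (α₁ , α₂ , α₃)
  K : Set c
  K = Carrier × Carrier × Carrier

  _≈K_ : K → K → Set ℓ
  (a₁ , a₂ , a₃) ≈K (b₁ , b₂ , b₃) = (a₁ ≈ b₁) × (a₂ ≈ b₂) × (a₃ ≈ b₃)

  0K : K
  0K = 0# , 0# , 0#

  ι : Carrier → K
  ι x = x , 0# , 0#

  t¹ t² : K
  t¹ = 0# , 1# , 0#
  t² = 0# , 0# , 1#

  _+K_ : K → K → K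
  (a₁ , a₂ , a₃) +K (b₁ , b₂ , b₃) = (a₁ + b₁) , (a₂ + b₂) , (a₃ + b₃)

  -- multiplication using (δ^{1/3})³ = δ
  _*K_ : K → K → K
  (a₁ , a₂ , a₃) *K (b₁ , b₂ , b₃) =
    (a₁ * b₁ + δ * (a₂ * b₃ + a₃ * b₂)) ,
    (a₁ * b₂ + a₂ * b₁ + δ * (a₃ * b₃)) ,
    (a₁ * b₃ + a₂ * b₂ + a₃ * b₁)

  _·K_ : Carrier → K → K
  x ·K α = ι x *K α

  InH : K × K → Set ℓ
  InH ((α₁ , α₂ , α₃) , (β₁ , β₂ , β₃)) = ¬ ((α₂ * β₃ - α₃ * β₂) ≈ 0#)

  Mat3 : Set c
  Mat3 = Fin 3 → Fin 3 → Carrier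

  i0 i1 i2 : Fin 3
  i0 = Fin.zero
  i1 = Fin.suc Fin.zero
  i2 = Fin.suc (Fin.suc Fin.zero)

  det : Mat3 → Carrier
  det m =
      m i0 i0 * (m i1 i1 * m i2 i2 - m i1 i2 * m i2 i1)
    - m i0 i1 * (m i1 i0 * m i2 i2 - m i1 i2 * m i2 i0)
    + m i0 i2 * (m i1 i0 * m i2 i1 - m i1 i1 * m i2 i0)

  InGL3 : Mat3 → Set ℓ
  InGL3 m = ¬ (det m ≈ 0#)

  InB : Mat3 → Set ℓ
  InB m = InGL3 m × (m i1 i0 ≈ 0#) × (m i2 i0 ≈ 0#) × (m i2 i1 ≈ 0#)

  -- Acts g x y  means  g · x = y  for the action in the context:
  --   g·(α,β) = ((aα+bβ+c)/(rα+sβ+t) , (dα+eβ+f)/(rα+sβ+t)).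
  -- The quotients in the field F(δ^{1/3}) are expressed by the defining
  -- equations  α' · D = N₁,  β' · D = N₂  with D ≠ 0.
  Acts : Mat3 → K × K → K × K → Set ℓ
  Acts m (α , β) (α' , β') =
      ¬ (D ≈K 0K) × ((α' *K D) ≈K N₁) × ((β' *K D) ≈K N₂)
    where
      D  = ((m i2 i0 ·K α) +K (m i2 i1 ·K β)) +K ι (m i2 i2)
      N₁ = ((m i0 i0 ·K α) +K (m i0 i1 ·K β)) +K ι (m i0 i2)
      N₂ = ((m i1 i0 ·K α) +K (m i1 i1 ·K β)) +K ι (m i1 i2)

  InBOrbit : K × K → K × K → Set (c ⊔ ℓ)
  InBOrbit x y = Σ Mat3 λ g → InB g × Acts g x y

  _≈P_ : K × K → K × K → Set ℓ
  (α , β) ≈P (α' , β') = (α ≈K α') × (β ≈K β')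

  InDomain : K × K → Set (c ⊔ ℓ)
  InDomain x = (Σ Carrier λ v → x ≈P (t¹ , ((v ·K t¹) +K t²))) ⊎ (x ≈P (t² , t¹))

  IsFundamentalDomainB : (K × K → Set (c ⊔ ℓ)) → Set (c ⊔ ℓ)
  IsFundamentalDomainB S =
      (∀ x → S x → InH x)
    × (∀ x → InH x → Σ (K × K) λ y → S y × InBOrbit x y)
    × (∀ y z → S y → S z → InBOrbit y z → y ≈P z)

-- An upper-triangular g has constant denominator t = g₃₃, so it acts affinely:
-- (α , β) ↦ ((aα + bβ + c) / t , (eβ + f) / t). With e and f one moves β to
-- v δ^{1/3} + δ^{2/3} if β₃ ≠ 0 and to δ^{1/3} if β₃ = 0; since α₂β₃ − α₃β₂ ≠ 0, a suitable
-- combination aα + bβ + c is then δ^{1/3}, respectively δ^{2/3}. Conversely, the δ^{2/3}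
-- coordinate of β is only rescaled by e / t ≠ 0, which separates the two families and
-- forces e = t, hence equal v, within the first.
module Submission where

open import Defs
open import Level using (Level; _⊔_)
open import Data.Nat as ℕ using (ℕ; zero; suc; _^_; _%_)
open import Data.Nat.Primality using (Prime)
open import Relation.Binary.PropositionalEquality using (_≡_)
open import Algebra.Bundles using (CommutativeRing)
open import Algebra.Solver.Ring.AlmostCommutativeRing using (fromCommutativeRing; _-Raw-AlmostCommutative⟶_)
open import Data.Fin as Fin using (Fin)
open import Data.Integer as ℤ using (ℤ; +_; -[1+_]; _⊖_; _◃_; sign; ∣_∣)
import Data.Integer.Properties as ℤ
open import Data.Maybe using (Maybe; just; nothing)
import Data.Nat.Properties as ℕ
open import Data.Product using (Σ; _×_; _,_; proj₁; proj₂)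
open import Data.Product.Relation.Binary.Pointwise.NonDependent using (×-setoid)
open import Data.Sign as Sign using (Sign)
open import Data.Sum using (_⊎_; inj₁; inj₂)
open import Data.Empty using (⊥-elim)
open import Function.Properties.Inverse using (Inverse⇒Injection)
open import Relation.Binary.Bundles using (Setoid)
import Relation.Binary.PropositionalEquality as ≡
open import Relation.Nullary using (¬_; Dec; yes; no)
open import Relation.Nullary.Decidable using (via-injection)

-- The ring solver needs a coefficient ring mapped into R. With ℤ as coefficients it also
-- decides identities that rely on cancellation (x - x ≈ 0#), which it cannot do with the
-- coefficients of R itself.
module IntegerCoefficients {c ℓ} (R : CommutativeRing c ℓ) where
  open CommutativeRing R
  open import Algebra.Properties.Ring ring using (-0#≈0#; -‿involutive; -‿+-comm; -‿distribˡ-*; -‿distribʳ-*)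
  import Algebra.Properties.Semiring.Mult.TCOptimised semiring as Mult
  open import Relation.Binary.Reasoning.Setoid setoid

  fromℕ : ℕ → Carrier
  fromℕ n = n Mult.× 1#

  fromℤ : ℤ → Carrier
  fromℤ (+ n)    = fromℕ n
  fromℤ -[1+ n ] = - fromℕ (suc n)

  x-0#≈x : ∀ x → x - 0# ≈ x
  x-0#≈x x = trans (+-congˡ -0#≈0#) (+-identityʳ x)

  [x+y]-[x+z]≈y-z : ∀ x y z → (x + y) - (x + z) ≈ y - z
  [x+y]-[x+z]≈y-z x y z = begin
    (x + y) + - (x + z)   ≈⟨ +-congˡ (-‿+-comm x z) ⟨
    (x + y) + (- x + - z) ≈⟨ +-assoc x y (- x + - z) ⟩
    x + (y + (- x + - z)) ≈⟨ +-congˡ (+-assoc y (- x) (- z)) ⟨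
    x + ((y + - x) + - z) ≈⟨ +-congˡ (+-congʳ (+-comm y (- x))) ⟩
    x + ((- x + y) + - z) ≈⟨ +-congˡ (+-assoc (- x) y (- z)) ⟩
    x + (- x + (y + - z)) ≈⟨ +-assoc x (- x) (y + - z) ⟨
    (x + - x) + (y + - z) ≈⟨ +-congʳ (-‿inverseʳ x) ⟩
    0# + (y + - z)        ≈⟨ +-identityˡ _ ⟩
    y - z                 ∎

  fromℤ-⊖ : ∀ m n → fromℤ (m ⊖ n) ≈ fromℕ m - fromℕ n
  fromℤ-⊖ m zero rewrite ℤ.⊖-≥ (ℕ.z≤n {m}) = sym (x-0#≈x (fromℕ m))
  fromℤ-⊖ zero (suc n) rewrite ℤ.⊖-< (ℕ.s≤s (ℕ.z≤n {n})) = sym (+-identityˡ _)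
  fromℤ-⊖ (suc m) (suc n) rewrite ℤ.[1+m]⊖[1+n]≡m⊖n m n = begin
    fromℤ (m ⊖ n)                     ≈⟨ fromℤ-⊖ m n ⟩
    fromℕ m - fromℕ n                 ≈⟨ [x+y]-[x+z]≈y-z 1# (fromℕ m) (fromℕ n) ⟨
    (1# + fromℕ m) - (1# + fromℕ n)   ≈⟨ +-cong (Mult.1+× m 1#) (-‿cong (Mult.1+× n 1#)) ⟨
    fromℕ (suc m) - fromℕ (suc n)     ∎

  fromℤ-+ : ∀ i j → fromℤ (i ℤ.+ j) ≈ fromℤ i + fromℤ j
  fromℤ-+ (+ m)    (+ n)    = Mult.×-homo-+ 1# m n
  fromℤ-+ (+ m)    -[1+ n ] = fromℤ-⊖ m (suc n)
  fromℤ-+ -[1+ m ] (+ n)    = trans (fromℤ-⊖ n (suc m)) (+-comm _ _)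
  fromℤ-+ -[1+ m ] -[1+ n ] = begin
    - fromℕ (suc (suc (m ℕ.+ n)))   ≡⟨ ≡.cong (λ k → - fromℕ (suc k)) (ℕ.+-suc m n) ⟨
    - fromℕ (suc m ℕ.+ suc n)       ≈⟨ -‿cong (Mult.×-homo-+ 1# (suc m) (suc n)) ⟩
    - (fromℕ (suc m) + fromℕ (suc n)) ≈⟨ -‿+-comm _ _ ⟨
    - fromℕ (suc m) + - fromℕ (suc n) ∎

  fromℤ-neg : ∀ i → fromℤ (ℤ.- i) ≈ - fromℤ i
  fromℤ-neg -[1+ n ]    = sym (-‿involutive _)
  fromℤ-neg (+ zero)    = sym -0#≈0#
  fromℤ-neg (+ suc n)   = refl

  signed : Sign → Carrier → Carrier
  signed Sign.+ x = x
  signed Sign.- x = - x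

  signed-cong : ∀ s {x y} → x ≈ y → signed s x ≈ signed s y
  signed-cong Sign.+ x≈y = x≈y
  signed-cong Sign.- x≈y = -‿cong x≈y

  signed-* : ∀ s t x y → signed (s Sign.* t) (x * y) ≈ signed s x * signed t y
  signed-* Sign.+ Sign.+ x y = refl
  signed-* Sign.+ Sign.- x y = -‿distribʳ-* x y
  signed-* Sign.- Sign.+ x y = -‿distribˡ-* x y
  signed-* Sign.- Sign.- x y = begin
    x * y       ≈⟨ -‿involutive _ ⟨
    - - (x * y) ≈⟨ -‿cong (-‿distribʳ-* x y) ⟩
    - (x * - y) ≈⟨ -‿distribˡ-* x (- y) ⟩
    - x * - y   ∎

  fromℤ-◃ : ∀ s n → fromℤ (s ◃ n) ≈ signed s (fromℕ n)
  fromℤ-◃ Sign.+ zero    = refl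
  fromℤ-◃ Sign.- zero    = sym -0#≈0#
  fromℤ-◃ Sign.+ (suc n) = refl
  fromℤ-◃ Sign.- (suc n) = refl

  fromℤ-sign-abs : ∀ i → fromℤ i ≈ signed (sign i) (fromℕ ∣ i ∣)
  fromℤ-sign-abs (+ n)    = refl
  fromℤ-sign-abs -[1+ n ] = refl

  fromℤ-* : ∀ i j → fromℤ (i ℤ.* j) ≈ fromℤ i * fromℤ j
  fromℤ-* i j = begin
    fromℤ ((sign i Sign.* sign j) ◃ (∣ i ∣ ℕ.* ∣ j ∣))
      ≈⟨ fromℤ-◃ (sign i Sign.* sign j) (∣ i ∣ ℕ.* ∣ j ∣) ⟩
    signed (sign i Sign.* sign j) (fromℕ (∣ i ∣ ℕ.* ∣ j ∣))
      ≈⟨ signed-cong (sign i Sign.* sign j) (Mult.×1-homo-* ∣ i ∣ ∣ j ∣) ⟩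
    signed (sign i Sign.* sign j) (fromℕ ∣ i ∣ * fromℕ ∣ j ∣)
      ≈⟨ signed-* (sign i) (sign j) _ _ ⟩
    signed (sign i) (fromℕ ∣ i ∣) * signed (sign j) (fromℕ ∣ j ∣)
      ≈⟨ *-cong (fromℤ-sign-abs i) (fromℤ-sign-abs j) ⟨
    fromℤ i * fromℤ j ∎

  fromℤ-homomorphism : ℤ.+-*-rawRing -Raw-AlmostCommutative⟶ fromCommutativeRing R
  fromℤ-homomorphism = record
    { ⟦_⟧ = fromℤ ; +-homo = fromℤ-+ ; *-homo = fromℤ-* ; -‿homo = fromℤ-neg
    ; 0-homo = refl ; 1-homo = refl }

  fromℤ-≟ : ∀ i j → Maybe (fromℤ i ≈ fromℤ j)
  fromℤ-≟ i j with i ℤ.≟ j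
  ... | yes ≡.refl = just refl
  ... | no _       = nothing

  open import Algebra.Solver.Ring ℤ.+-*-rawRing (fromCommutativeRing R) fromℤ-homomorphism fromℤ-≟ public

module FieldProperties {c ℓ} (F : CommutativeRing c ℓ) (isField : IsField F) where
  open CommutativeRing F
  open IntegerCoefficients F using (solve; _:=_; _:*_)
  open import Relation.Binary.Reasoning.Setoid setoid

  0≉1 : ¬ 0# ≈ 1#
  0≉1 = proj₁ isField

  1≉0 : ¬ 1# ≈ 0#
  1≉0 1≈0 = 0≉1 (sym 1≈0)

  inverse : ∀ x → ¬ x ≈ 0# → Σ Carrier λ y → x * y ≈ 1#
  inverse = proj₂ isField

  *≈1⇒≉0 : ∀ {x y} → x * y ≈ 1# → ¬ x ≈ 0#
  *≈1⇒≉0 {x} {y} xy≈1 x≈0 = 0≉1 (begin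
    0#     ≈⟨ zeroˡ y ⟨
    0# * y ≈⟨ *-congʳ x≈0 ⟨
    x * y  ≈⟨ xy≈1 ⟩
    1#     ∎)

  *-≉0 : ∀ {x y} → ¬ x ≈ 0# → ¬ y ≈ 0# → ¬ x * y ≈ 0#
  *-≉0 {x} {y} x≉0 y≉0 xy≈0 = 0≉1 (begin
    0#                    ≈⟨ zeroˡ (x⁻¹ * y⁻¹) ⟨
    0# * (x⁻¹ * y⁻¹)      ≈⟨ *-congʳ xy≈0 ⟨
    (x * y) * (x⁻¹ * y⁻¹) ≈⟨ solve 4 (λ x y x' y' → (x :* y) :* (x' :* y') := (x :* x') :* (y :* y'))
                                     refl x y x⁻¹ y⁻¹ ⟩
    (x * x⁻¹) * (y * y⁻¹) ≈⟨ *-cong (proj₂ (inverse x x≉0)) (proj₂ (inverse y y≉0)) ⟩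
    1# * 1#               ≈⟨ *-identityˡ 1# ⟩
    1#                    ∎)
    where
      x⁻¹ = proj₁ (inverse x x≉0)
      y⁻¹ = proj₁ (inverse y y≉0)

  *-cancelʳ : ∀ {t x y} → ¬ t ≈ 0# → x * t ≈ y * t → x ≈ y
  *-cancelʳ {t} {x} {y} t≉0 xt≈yt = begin
    x               ≈⟨ *-identityʳ x ⟨
    x * 1#          ≈⟨ *-congˡ tt⁻¹≈1 ⟨
    x * (t * t⁻¹)   ≈⟨ *-assoc x t t⁻¹ ⟨
    (x * t) * t⁻¹   ≈⟨ *-congʳ xt≈yt ⟩
    (y * t) * t⁻¹   ≈⟨ *-assoc y t t⁻¹ ⟩
    y * (t * t⁻¹)   ≈⟨ *-congˡ tt⁻¹≈1 ⟩
    y * 1#          ≈⟨ *-identityʳ y ⟩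
    y               ∎
    where
      t⁻¹ = proj₁ (inverse t t≉0)
      tt⁻¹≈1 = proj₂ (inverse t t≉0)

module BorelFundamentalDomain {c ℓ} (F : CommutativeRing c ℓ) (isField : IsField F)
  (_≟_ : ∀ x y → Dec (CommutativeRing._≈_ F x y)) (δ : CommutativeRing.Carrier F) where
  open CommutativeRing F
  open CubicExt F δ
  open FieldProperties F isField
  open IntegerCoefficients F using (solve; _:=_; _:+_; _:*_; :-_; _:-_; con; Polynomial)
  open import Relation.Binary.Reasoning.Setoid setoid

  :0 :1 : ∀ {n} → Polynomial n
  :0 = con (+ 0)
  :1 = con (+ 1)

  Kˢ : Setoid c ℓ
  Kˢ = ×-setoid setoid (×-setoid setoid setoid)

  Pˢ : Setoid c ℓ
  Pˢ = ×-setoid Kˢ Kˢ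

  module K = Setoid Kˢ
  module P = Setoid Pˢ

  affine : Carrier → Carrier → Carrier → K → K → K
  affine a b c' (α₁ , α₂ , α₃) (β₁ , β₂ , β₃) =
    a * α₁ + b * β₁ + c' , a * α₂ + b * β₂ , a * α₃ + b * β₃

  affine-correct : ∀ a b c' α β → (((a ·K α) +K (b ·K β)) +K ι c') ≈K affine a b c' α β
  affine-correct a b c' (α₁ , α₂ , α₃) (β₁ , β₂ , β₃) =
      solve 10 (λ d a b c' α₁ α₂ α₃ β₁ β₂ β₃ →
        (a :* α₁ :+ d :* (:0 :* α₃ :+ :0 :* α₂)) :+ (b :* β₁ :+ d :* (:0 :* β₃ :+ :0 :* β₂)) :+ c'
        := a :* α₁ :+ b :* β₁ :+ c') refl δ a b c' α₁ α₂ α₃ β₁ β₂ β₃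
    , solve 10 (λ d a b c' α₁ α₂ α₃ β₁ β₂ β₃ →
        (a :* α₂ :+ :0 :* α₁ :+ d :* (:0 :* α₃)) :+ (b :* β₂ :+ :0 :* β₁ :+ d :* (:0 :* β₃)) :+ :0
        := a :* α₂ :+ b :* β₂) refl δ a b c' α₁ α₂ α₃ β₁ β₂ β₃
    , solve 10 (λ d a b c' α₁ α₂ α₃ β₁ β₂ β₃ →
        (a :* α₃ :+ :0 :* α₂ :+ :0 :* α₁) :+ (b :* β₃ :+ :0 :* β₂ :+ :0 :* β₁) :+ :0
        := a :* α₃ :+ b :* β₃) refl δ a b c' α₁ α₂ α₃ β₁ β₂ β₃

  affine-constant : ∀ {r s} t α β → r ≈ 0# → s ≈ 0# → affine r s t α β ≈K ι t
  affine-constant {r} {s} t (α₁ , α₂ , α₃) (β₁ , β₂ , β₃) r≈0 s≈0 =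
      trans (+-congʳ (vanishes α₁ β₁)) (+-identityˡ t) , vanishes α₂ β₂ , vanishes α₃ β₃
    where
      vanishes : ∀ x y → r * x + s * y ≈ 0#
      vanishes x y = trans (+-cong (*-congʳ r≈0) (*-congʳ s≈0))
        (solve 2 (λ x y → :0 :* x :+ :0 :* y := :0) refl x y)

  infixl 7 _*ι_
  _*ι_ : K → Carrier → K
  (α₁ , α₂ , α₃) *ι t = α₁ * t , α₂ * t , α₃ * t

  *K-ι : ∀ α t → (α *K ι t) ≈K (α *ι t)
  *K-ι (α₁ , α₂ , α₃) t =
      solve 5 (λ d α₁ α₂ α₃ t → α₁ :* t :+ d :* (α₂ :* :0 :+ α₃ :* :0) := α₁ :* t) refl δ α₁ α₂ α₃ t
    , solve 5 (λ d α₁ α₂ α₃ t → α₁ :* :0 :+ α₂ :* t :+ d :* (α₃ :* :0) := α₂ :* t) refl δ α₁ α₂ α₃ t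
    , solve 5 (λ d α₁ α₂ α₃ t → α₁ :* :0 :+ α₂ :* :0 :+ α₃ :* t := α₃ :* t) refl δ α₁ α₂ α₃ t

  *K-congˡ : ∀ α {β β'} → β ≈K β' → (α *K β) ≈K (α *K β')
  *K-congˡ (α₁ , α₂ , α₃) (e₁ , e₂ , e₃) =
      +-cong (*-congˡ e₁) (*-congˡ (+-cong (*-congˡ e₃) (*-congˡ e₂)))
    , +-cong (+-cong (*-congˡ e₂) (*-congˡ e₁)) (*-congˡ (*-congˡ e₃))
    , +-cong (+-cong (*-congˡ e₃) (*-congˡ e₂)) (*-congˡ e₁)

  row : Mat3 → Fin 3 → K → K → K
  row g i = affine (g i i0) (g i i1) (g i i2)

  row-correct : ∀ g i α β → (((g i i0 ·K α) +K (g i i1 ·K β)) +K ι (g i i2)) ≈K row g i α β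
  row-correct g i = affine-correct (g i i0) (g i i1) (g i i2)

  -- For g with vanishing bottom row off the diagonal, the denominator of g · (α , β)
  -- is the constant g₃₃, so the action is affine.
  ActsUpper : Mat3 → K × K → K × K → Set ℓ
  ActsUpper g (α , β) (α' , β') =
    ¬ (g i2 i2 ≈ 0#) × ((α' *ι g i2 i2) ≈K row g i0 α β) × ((β' *ι g i2 i2) ≈K row g i1 α β)

  denominator-upper : ∀ g α β → g i2 i0 ≈ 0# → g i2 i1 ≈ 0#
    → (((g i2 i0 ·K α) +K (g i2 i1 ·K β)) +K ι (g i2 i2)) ≈K ι (g i2 i2)
  denominator-upper g α β r≈0 s≈0 =
    K.trans (row-correct g i2 α β) (affine-constant (g i2 i2) α β r≈0 s≈0)

  Acts⇒ActsUpper : ∀ g α β α' β' → g i2 i0 ≈ 0# → g i2 i1 ≈ 0#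
    → Acts g (α , β) (α' , β') → ActsUpper g (α , β) (α' , β')
  Acts⇒ActsUpper g α β α' β' r≈0 s≈0 (D≉0 , α'D≈N₁ , β'D≈N₂) =
      (λ t≈0 → D≉0 (K.trans D≈t (t≈0 , refl , refl)))
    , K.trans (K.sym (*K-ι α' t)) (K.trans (K.sym (*K-congˡ α' D≈t)) (K.trans α'D≈N₁ (row-correct g i0 α β)))
    , K.trans (K.sym (*K-ι β' t)) (K.trans (K.sym (*K-congˡ β' D≈t)) (K.trans β'D≈N₂ (row-correct g i1 α β)))
    where
      t = g i2 i2
      D≈t = denominator-upper g α β r≈0 s≈0

  ActsUpper⇒Acts : ∀ g α β α' β' → g i2 i0 ≈ 0# → g i2 i1 ≈ 0#
    → ActsUpper g (α , β) (α' , β') → Acts g (α , β) (α' , β')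
  ActsUpper⇒Acts g α β α' β' r≈0 s≈0 (t≉0 , α't≈row₀ , β't≈row₁) =
      (λ D≈0 → t≉0 (trans (sym (proj₁ D≈t)) (proj₁ D≈0)))
    , K.trans (*K-congˡ α' D≈t) (K.trans (*K-ι α' t) (K.trans α't≈row₀ (K.sym (row-correct g i0 α β))))
    , K.trans (*K-congˡ β' D≈t) (K.trans (*K-ι β' t) (K.trans β't≈row₁ (K.sym (row-correct g i1 α β))))
    where
      t = g i2 i2
      D≈t = denominator-upper g α β r≈0 s≈0

  det-upper : ∀ g → g i1 i0 ≈ 0# → g i2 i0 ≈ 0# → g i2 i1 ≈ 0# → det g ≈ g i0 i0 * (g i1 i1 * g i2 i2)
  det-upper g d≈0 r≈0 s≈0 = begin
    det g
      ≈⟨ solve 9 (λ a b c' d e f r s t →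
           a :* (e :* t :- f :* s) :- b :* (d :* t :- f :* r) :+ c' :* (d :* s :- e :* r)
           := a :* (e :* t) :+ (s :* (:- (a :* f)) :+ d :* (c' :* s :- b :* t) :+ r :* (b :* f :- c' :* e)))
           refl a b c' d e f r s t ⟩
    a * (e * t) + (s * (- (a * f)) + d * (c' * s - b * t) + r * (b * f - c' * e))
      ≈⟨ +-congˡ (+-cong (+-cong (*-congʳ s≈0) (*-congʳ d≈0)) (*-congʳ r≈0)) ⟩
    a * (e * t) + (0# * (- (a * f)) + 0# * (c' * s - b * t) + 0# * (b * f - c' * e))
      ≈⟨ solve 4 (λ p x y z → p :+ (:0 :* x :+ :0 :* y :+ :0 :* z) := p) refl _ _ _ _ ⟩
    a * (e * t) ∎
    where
      a = g i0 i0 ; b = g i0 i1 ; c' = g i0 i2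
      d = g i1 i0 ; e = g i1 i1 ; f = g i1 i2
      r = g i2 i0 ; s = g i2 i1 ; t = g i2 i2

  upper : (a b c' e f t : Carrier) → Mat3
  upper a b c' e f t Fin.zero                     Fin.zero                     = a
  upper a b c' e f t Fin.zero                     (Fin.suc Fin.zero)           = b
  upper a b c' e f t Fin.zero                     (Fin.suc (Fin.suc Fin.zero)) = c'
  upper a b c' e f t (Fin.suc Fin.zero)           (Fin.suc Fin.zero)           = e
  upper a b c' e f t (Fin.suc Fin.zero)           (Fin.suc (Fin.suc Fin.zero)) = f
  upper a b c' e f t (Fin.suc (Fin.suc Fin.zero)) (Fin.suc (Fin.suc Fin.zero)) = t
  upper a b c' e f t _ _ = 0#

  upper-InB : ∀ a b c' e f t → ¬ a * (e * t) ≈ 0# → InB (upper a b c' e f t)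
  upper-InB a b c' e f t aet≉0 =
    (λ det≈0 → aet≉0 (trans (sym (det-upper (upper a b c' e f t) refl refl refl)) det≈0)) , refl , refl , refl

  upper₁-acts : ∀ {a b c' e f α β α' β'} → α' ≈K affine a b c' α β → β' ≈K affine 0# e f α β
    → Acts (upper a b c' e f 1#) (α , β) (α' , β')
  upper₁-acts {α = α} {β} {α'} {β'} α'≈row₀ β'≈row₁ =
    ActsUpper⇒Acts (upper _ _ _ _ _ 1#) α β α' β' refl refl
      (1≉0 , K.trans (*ι-1# α') α'≈row₀ , K.trans (*ι-1# β') β'≈row₁)
    where
      *ι-1# : ∀ γ → (γ *ι 1#) ≈K γ
      *ι-1# (γ₁ , γ₂ , γ₃) = *-identityʳ γ₁ , *-identityʳ γ₂ , *-identityʳ γ₃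

  line-coordinates : ∀ v → ((v ·K t¹) +K t²) ≈K (0# , v , 1#)
  line-coordinates v =
      solve 2 (λ d v → v :* :0 :+ d :* (:0 :* :0 :+ :0 :* :1) :+ :0 := :0) refl δ v
    , solve 2 (λ d v → v :* :1 :+ :0 :* :0 :+ d :* (:0 :* :0) :+ :0 := v) refl δ v
    , solve 1 (λ v → v :* :0 :+ :0 :* :1 :+ :0 :* :0 :+ :1 := :1) refl v

  -- a and b solve a α₂ + b β₂ = 1, a α₃ + b β₃ = 0 (Cramer's rule); c', f clear the first coordinates.
  orbit-meets-line : ∀ {α₁ α₂ α₃ β₁ β₂ β₃ u Δ⁻¹} → β₃ * u ≈ 1# → (α₂ * β₃ - α₃ * β₂) * Δ⁻¹ ≈ 1#
    → InBOrbit ((α₁ , α₂ , α₃) , (β₁ , β₂ , β₃)) (t¹ , ((β₂ * u) ·K t¹) +K t²)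
  orbit-meets-line {α₁} {α₂} {α₃} {β₁} {β₂} {β₃} {u} {Δ⁻¹} β₃u≈1 ΔΔ⁻¹≈1 =
      upper a b c' u f 1#
    , upper-InB a b c' u f 1# (*-≉0 (*-≉0 β₃≉0 Δ⁻¹≉0) (*-≉0 u≉0 1≉0))
    , upper₁-acts α-row (K.trans (line-coordinates (β₂ * u)) β-row)
    where
      a = β₃ * Δ⁻¹
      b = - (α₃ * Δ⁻¹)
      c' = - (a * α₁ + b * β₁)
      f = - (u * β₁)
      β₃≉0 = *≈1⇒≉0 β₃u≈1
      u≉0 = *≈1⇒≉0 (trans (*-comm u β₃) β₃u≈1)
      Δ⁻¹≉0 = *≈1⇒≉0 (trans (*-comm Δ⁻¹ _) ΔΔ⁻¹≈1)
      α-row : t¹ ≈K affine a b c' (α₁ , α₂ , α₃) (β₁ , β₂ , β₃)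
      α-row =
          sym (-‿inverseʳ _)
        , trans (sym ΔΔ⁻¹≈1) (solve 5 (λ α₂ α₃ β₂ β₃ Δ⁻¹ →
            (α₂ :* β₃ :- α₃ :* β₂) :* Δ⁻¹ := β₃ :* Δ⁻¹ :* α₂ :+ (:- (α₃ :* Δ⁻¹)) :* β₂) refl α₂ α₃ β₂ β₃ Δ⁻¹)
        , solve 3 (λ α₃ β₃ Δ⁻¹ → :0 := β₃ :* Δ⁻¹ :* α₃ :+ (:- (α₃ :* Δ⁻¹)) :* β₃) refl α₃ β₃ Δ⁻¹
      β-row : (0# , β₂ * u , 1#) ≈K affine 0# u f (α₁ , α₂ , α₃) (β₁ , β₂ , β₃)
      β-row =
          solve 3 (λ α₁ u β₁ → :0 := :0 :* α₁ :+ u :* β₁ :+ :- (u :* β₁)) refl α₁ u β₁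
        , solve 3 (λ β₂ u α₂ → β₂ :* u := :0 :* α₂ :+ u :* β₂) refl β₂ u α₂
        , trans (sym β₃u≈1) (solve 3 (λ β₃ u α₃ → β₃ :* u := :0 :* α₃ :+ u :* β₃) refl β₃ u α₃)

  orbit-meets-point : ∀ {α₁ α₂ α₃ β₁ β₂ β₃ u w} → β₃ ≈ 0# → β₂ * u ≈ 1# → α₃ * w ≈ 1#
    → InBOrbit ((α₁ , α₂ , α₃) , (β₁ , β₂ , β₃)) (t² , t¹)
  orbit-meets-point {α₁} {α₂} {α₃} {β₁} {β₂} {β₃} {u} {w} β₃≈0 β₂u≈1 α₃w≈1 =
      upper w b c' u f 1#
    , upper-InB w b c' u f 1# (*-≉0 w≉0 (*-≉0 u≉0 1≉0))
    , upper₁-acts α-row β-row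
    where
      b = - (α₂ * w * u)
      c' = - (w * α₁ + b * β₁)
      f = - (u * β₁)
      w≉0 = *≈1⇒≉0 (trans (*-comm w α₃) α₃w≈1)
      u≉0 = *≈1⇒≉0 (trans (*-comm u β₂) β₂u≈1)
      α-row : t² ≈K affine w b c' (α₁ , α₂ , α₃) (β₁ , β₂ , β₃)
      α-row =
          sym (-‿inverseʳ _)
        , (begin
            0#                              ≈⟨ solve 2 (λ α₂ w → :0 := α₂ :* w :* :1 :- α₂ :* w :* :1) refl α₂ w ⟩
            α₂ * w * 1# - α₂ * w * 1#       ≈⟨ +-congˡ (-‿cong (*-congˡ β₂u≈1)) ⟨
            α₂ * w * 1# - α₂ * w * (β₂ * u) ≈⟨ solve 4 (λ α₂ w β₂ u →
                                                  α₂ :* w :* :1 :- α₂ :* w :* (β₂ :* u) := w :* α₂ :+ (:- (α₂ :* w :* u)) :* β₂)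
                                                refl α₂ w β₂ u ⟩
            w * α₂ + b * β₂                 ∎)
        , (begin
            1#              ≈⟨ α₃w≈1 ⟨
            α₃ * w          ≈⟨ solve 3 (λ α₃ w b → α₃ :* w := w :* α₃ :+ b :* :0) refl α₃ w b ⟩
            w * α₃ + b * 0# ≈⟨ +-congˡ (*-congˡ β₃≈0) ⟨
            w * α₃ + b * β₃ ∎)
      β-row : t¹ ≈K affine 0# u f (α₁ , α₂ , α₃) (β₁ , β₂ , β₃)
      β-row =
          solve 3 (λ α₁ u β₁ → :0 := :0 :* α₁ :+ u :* β₁ :+ :- (u :* β₁)) refl α₁ u β₁
        , trans (sym β₂u≈1) (solve 3 (λ β₂ u α₂ → β₂ :* u := :0 :* α₂ :+ u :* β₂) refl β₂ u α₂)
        , trans (solve 2 (λ α₃ u → :0 := :0 :* α₃ :+ u :* :0) refl α₃ u) (+-congˡ (*-congˡ (sym β₃≈0)))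

  InH-β₃≈0 : ∀ {α₁ α₂ α₃ β₁ β₂ β₃} → β₃ ≈ 0# → InH ((α₁ , α₂ , α₃) , (β₁ , β₂ , β₃))
    → ¬ α₃ ≈ 0# × ¬ β₂ ≈ 0#
  InH-β₃≈0 {α₂ = α₂} {α₃} {β₂ = β₂} β₃≈0 Δ≉0 =
      (λ α₃≈0 → Δ≉0 (trans (+-cong (*-congˡ β₃≈0) (-‿cong (*-congʳ α₃≈0)))
                           (solve 2 (λ α₂ β₂ → α₂ :* :0 :- :0 :* β₂ := :0) refl α₂ β₂)))
    , (λ β₂≈0 → Δ≉0 (trans (+-cong (*-congˡ β₃≈0) (-‿cong (*-congˡ β₂≈0)))
                           (solve 2 (λ α₂ α₃ → α₂ :* :0 :- α₃ :* :0 := :0) refl α₂ α₃)))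

  orbit-meets-domain : ∀ x → InH x → Σ (K × K) λ y → InDomain y × InBOrbit x y
  orbit-meets-domain ((α₁ , α₂ , α₃) , (β₁ , β₂ , β₃)) Δ≉0 with β₃ ≟ 0#
  ... | no β₃≉0 =
    (t¹ , ((β₂ * u) ·K t¹) +K t²) , inj₁ (β₂ * u , P.refl) ,
    orbit-meets-line (proj₂ (inverse β₃ β₃≉0)) (proj₂ (inverse _ Δ≉0))
    where u = proj₁ (inverse β₃ β₃≉0)
  ... | yes β₃≈0 =
    (t² , t¹) , inj₂ P.refl ,
    orbit-meets-point β₃≈0 (proj₂ (inverse β₂ β₂≉0)) (proj₂ (inverse α₃ α₃≉0))
    where
      α₃≉0 = proj₁ (InH-β₃≈0 {α₁} {β₁ = β₁} β₃≈0 Δ≉0)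
      β₂≉0 = proj₂ (InH-β₃≈0 {α₁} {β₁ = β₁} β₃≈0 Δ≉0)

  line : Carrier → K × K
  line v = t¹ , (0# , v , 1#)

  Normal : K × K → Set (c ⊔ ℓ)
  Normal x = (Σ Carrier λ v → x ≈P line v) ⊎ x ≈P (t² , t¹)

  InDomain⇒Normal : ∀ {x} → InDomain x → Normal x
  InDomain⇒Normal (inj₁ (v , α≈t¹ , β≈)) = inj₁ (v , α≈t¹ , K.trans β≈ (line-coordinates v))
  InDomain⇒Normal (inj₂ x≈point)         = inj₂ x≈point

  InH-resp : ∀ {x y} → x ≈P y → InH y → InH x
  InH-resp ((_ , α₂≈ , α₃≈) , (_ , β₂≈ , β₃≈)) Δy≉0 Δx≈0 =
    Δy≉0 (trans (sym (+-cong (*-cong α₂≈ β₃≈) (-‿cong (*-cong α₃≈ β₂≈)))) Δx≈0)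

  InDomain⇒InH : ∀ x → InDomain x → InH x
  InDomain⇒InH x x∈D with InDomain⇒Normal x∈D
  ... | inj₁ (v , x≈line) = InH-resp x≈line λ Δ≈0 →
          1≉0 (trans (solve 1 (λ v → :1 := :1 :* :1 :- :0 :* v) refl v) Δ≈0)
  ... | inj₂ x≈point = InH-resp x≈point λ Δ≈0 →
          1≉0 (trans (solve 0 (:1 := :- (:0 :* :0 :- :1 :* :1)) refl)
                     (trans (-‿cong Δ≈0) (solve 0 (:- :0 := :0) refl)))

  second-row : ∀ g {α₁ α₂ α₃ β₁ β₂ β₃ α' β₁' β₂' β₃'} → g i1 i0 ≈ 0#
    → ActsUpper g ((α₁ , α₂ , α₃) , (β₁ , β₂ , β₃)) (α' , (β₁' , β₂' , β₃'))
    → (β₂' * g i2 i2 ≈ g i1 i1 * β₂) × (β₃' * g i2 i2 ≈ g i1 i1 * β₃)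
  second-row g {α₂ = α₂} {α₃} {β₂ = β₂} {β₃} d≈0 (_ , _ , _ , β₂'t≈ , β₃'t≈) =
    trans β₂'t≈ (drop α₂ β₂) , trans β₃'t≈ (drop α₃ β₃)
    where
      drop : ∀ x y → g i1 i0 * x + g i1 i1 * y ≈ g i1 i1 * y
      drop x y = trans (+-congʳ (trans (*-congʳ d≈0) (zeroˡ x))) (+-identityˡ _)

  InB⇒g₂₂≉0 : ∀ g → InB g → ¬ g i1 i1 ≈ 0#
  InB⇒g₂₂≉0 g (det≉0 , d≈0 , r≈0 , s≈0) e≈0 = det≉0 (begin
    det g                      ≈⟨ det-upper g d≈0 r≈0 s≈0 ⟩
    g i0 i0 * (g i1 i1 * g i2 i2) ≈⟨ *-congˡ (*-congʳ e≈0) ⟩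
    g i0 i0 * (0# * g i2 i2)   ≈⟨ solve 2 (λ a t → a :* (:0 :* t) := :0) refl (g i0 i0) (g i2 i2) ⟩
    0#                         ∎)

  -- Only the third coordinates are needed: they force e = t on the line, and rule out
  -- moving between the line and the point since e and t are nonzero.
  normal-orbit-unique : ∀ {α β₁ β₂ β₃ α' β₁' β₂' β₃' e t} → ¬ e ≈ 0# → ¬ t ≈ 0#
    → β₂' * t ≈ e * β₂ → β₃' * t ≈ e * β₃
    → Normal (α , (β₁ , β₂ , β₃)) → Normal (α' , (β₁' , β₂' , β₃'))
    → (α , (β₁ , β₂ , β₃)) ≈P (α' , (β₁' , β₂' , β₃'))
  normal-orbit-unique {β₂ = β₂} {β₃} {β₂' = β₂'} {β₃'} {e} {t} e≉0 t≉0 β₂'t≈eβ₂ β₃'t≈eβ₃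
    (inj₁ (v , y≈line@(_ , _ , β₂≈v , β₃≈1))) (inj₁ (w , z≈line@(_ , _ , β₂'≈w , β₃'≈1))) =
    P.trans y≈line (P.trans (K.refl , refl , sym w≈v , refl) (P.sym z≈line))
    where
      t≈e : t ≈ e
      t≈e = begin
        t       ≈⟨ *-identityˡ t ⟨
        1# * t  ≈⟨ *-congʳ β₃'≈1 ⟨
        β₃' * t ≈⟨ β₃'t≈eβ₃ ⟩
        e * β₃  ≈⟨ *-congˡ β₃≈1 ⟩
        e * 1#  ≈⟨ *-identityʳ e ⟩
        e       ∎
      w≈v : w ≈ v
      w≈v = *-cancelʳ t≉0 (begin
        w * t   ≈⟨ *-congʳ β₂'≈w ⟨
        β₂' * t ≈⟨ β₂'t≈eβ₂ ⟩
        e * β₂  ≈⟨ *-cong (sym t≈e) β₂≈v ⟩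
        t * v   ≈⟨ *-comm t v ⟩
        v * t   ∎)
  normal-orbit-unique {β₃ = β₃} {β₃' = β₃'} {e} {t} e≉0 t≉0 _ β₃'t≈eβ₃
    (inj₁ (_ , _ , _ , _ , β₃≈1)) (inj₂ (_ , _ , _ , β₃'≈0)) = ⊥-elim (e≉0 (begin
      e       ≈⟨ *-identityʳ e ⟨
      e * 1#  ≈⟨ *-congˡ β₃≈1 ⟨
      e * β₃  ≈⟨ β₃'t≈eβ₃ ⟨
      β₃' * t ≈⟨ *-congʳ β₃'≈0 ⟩
      0# * t  ≈⟨ zeroˡ t ⟩
      0#      ∎))
  normal-orbit-unique {β₃ = β₃} {β₃' = β₃'} {e} {t} e≉0 t≉0 _ β₃'t≈eβ₃
    (inj₂ (_ , _ , _ , β₃≈0)) (inj₁ (_ , _ , _ , _ , β₃'≈1)) = ⊥-elim (t≉0 (begin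
      t       ≈⟨ *-identityˡ t ⟨
      1# * t  ≈⟨ *-congʳ β₃'≈1 ⟨
      β₃' * t ≈⟨ β₃'t≈eβ₃ ⟩
      e * β₃  ≈⟨ *-congˡ β₃≈0 ⟩
      e * 0#  ≈⟨ zeroʳ e ⟩
      0#      ∎))
  normal-orbit-unique _ _ _ _ (inj₂ y≈point) (inj₂ z≈point) = P.trans y≈point (P.sym z≈point)

  domain-orbit-unique : ∀ y z → InDomain y → InDomain z → InBOrbit y z → y ≈P z
  domain-orbit-unique (α , β) (α' , β') y∈D z∈D (g , g∈B@(_ , d≈0 , r≈0 , s≈0) , g·y≈z) =
    normal-orbit-unique (InB⇒g₂₂≉0 g g∈B) t≉0 β₂'t≈eβ₂ β₃'t≈eβ₃ (InDomain⇒Normal y∈D) (InDomain⇒Normal z∈D)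
    where
      g·y≈z′ = Acts⇒ActsUpper g α β α' β' r≈0 s≈0 g·y≈z
      t≉0 = proj₁ g·y≈z′
      β₂'t≈eβ₂ = proj₁ (second-row g d≈0 g·y≈z′)
      β₃'t≈eβ₃ = proj₂ (second-row g d≈0 g·y≈z′)

  B-fundamentalDomain : IsFundamentalDomainB InDomain
  B-fundamentalDomain = InDomain⇒InH , orbit-meets-domain , domain-orbit-unique

HasCardinality⇒≈-dec : ∀ {c ℓ} (F : CommutativeRing c ℓ) {q} → HasCardinality F q
  → ∀ x y → Dec (CommutativeRing._≈_ F x y)
HasCardinality⇒≈-dec F card = via-injection (Inverse⇒Injection card) Fin._≟_

-- The arithmetic conditions on q
-- and the nonresidue δ are what make F(δ^{1/3}) a field in the paper.
proposition5p2 : {c ℓ : Level} (p n q : ℕ) → Prime p → q ≡ p ^ n → q % 3 ≡ 1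
    → (F : CommutativeRing c ℓ) → IsField F → HasCardinality F q
    → (δ : CommutativeRing.Carrier F) → CubicNonresidue F δ
    → CubicExt.IsFundamentalDomainB F δ (CubicExt.InDomain F δ)
proposition5p2 _ _ _ _ _ _ F isField card δ _ =
  BorelFundamentalDomain.B-fundamentalDomain F isField (HasCardinality⇒≈-dec F card) δ
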